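{- If $G\in Expand(H)$, then one can assign a non-negative integer $s(v)$ to every vertex $v$ of $H$ such that $|\mathcal V(G)|=\sum_{v\in\mathcal V(H)}s(v)$ and, for every clique $C$ of $H$, $\sum_{v\in C}s(v)\le \omega(G)$, where $\omega(G)$ is the clique number of $G$.
   Context: All graphs are finite, simple, undirected. For a graph $K$, $Expand(K)$ is the set of all graphs obtainable from $K$ by a finite sequence of the operations: (I) remove a vertex; (II) replace a vertex $v$ by a clique of arbitrary size, each new vertex joined to all neighbors of $v$; (III) add a new edge. -}

module Defs where

open import Data.Nat using (ℕ; zero; suc; _+_; _≤_)
open import Data.Fin using (Fin; zero; suc)
open import Data.Bool using (Bool; true; false; if_then_else_)
open import Data.Product using (Σ; ∃; _×_; _,_)
open import Data.Sum using (_⊎_)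
open import Relation.Binary.PropositionalEquality using (_≡_; _≢_)
open import Function.Bundles using (_⇔_)

record Graph : Set where
  field
    n      : ℕ
    adj    : Fin n → Fin n → Bool
    sym    : ∀ x y → adj x y ≡ adj y x
    irrefl : ∀ x → adj x x ≡ false
open Graph public

Vertex : Graph → Set
Vertex G = Fin (n G)

Adj : (G : Graph) → Vertex G → Vertex G → Set
Adj G x y = adj G x y ≡ true

sumFin : (k : ℕ) → (Fin k → ℕ) → ℕ
sumFin zero    f = 0
sumFin (suc k) f = f zero + sumFin k (λ i → f (suc i))

VSet : Graph → Set
VSet G = Vertex G → Bool

sumOver : (G : Graph) → VSet G → (Vertex G → ℕ) → ℕ
sumOver G C s = sumFin (n G) (λ v → if C v then s v else 0)

card : (G : Graph) → VSet G → ℕ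
card G C = sumOver G C (λ _ → 1)

IsClique : (G : Graph) → VSet G → Set
IsClique G C = ∀ x y → C x ≡ true → C y ≡ true → x ≢ y → Adj G x y

IsCliqueNumber : Graph → ℕ → Set
IsCliqueNumber G w =
  (Σ (VSet G) λ C → IsClique G C × card G C ≡ w) ×
  (∀ C → IsClique G C → card G C ≤ w)

RemoveVertex : (G G' : Graph) → Vertex G → Set
RemoveVertex G G' v =
  Σ (Vertex G' → Vertex G) λ f →
    (∀ x y → f x ≡ f y → x ≡ y) ×
    (∀ x → f x ≢ v) ×
    (∀ u → u ≢ v → ∃ λ x → f x ≡ u) ×
    (∀ x y → adj G' x y ≡ adj G (f x) (f y))

-- (II) G' is (a copy of) G with vertex v replaced by a clique (of size ≥ 1, the
-- fibre of p over v), each new vertex joined to all neighbours of v.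
ReplaceByClique : (G G' : Graph) → Vertex G → Set
ReplaceByClique G G' v =
  Σ (Vertex G' → Vertex G) λ p →
    (∀ u → ∃ λ x → p x ≡ u) ×
    (∀ x y → p x ≡ p y → p x ≡ v ⊎ x ≡ y) ×
    (∀ x y → x ≢ y → (Adj G' x y ⇔ (p x ≡ p y ⊎ Adj G (p x) (p y))))

AddEdge : (G G' : Graph) → Set
AddEdge G G' =
  Σ (Vertex G) λ u → Σ (Vertex G) λ v →
    u ≢ v × adj G u v ≡ false ×
    (Σ (Vertex G' → Vertex G) λ e →
      (∀ x y → e x ≡ e y → x ≡ y) ×
      (∀ z → ∃ λ x → e x ≡ z) ×
      (∀ x y → (Adj G' x y ⇔
                 (Adj G (e x) (e y) ⊎ (e x ≡ u × e y ≡ v) ⊎ (e x ≡ v × e y ≡ u)))))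

data Step (G G' : Graph) : Set where
  remove  : (v : Vertex G) → RemoveVertex G G' v → Step G G'
  replace : (v : Vertex G) → ReplaceByClique G G' v → Step G G'
  addEdge : AddEdge G G' → Step G G'

data Expand (K : Graph) : Graph → Set where
  done : Expand K K
  step : ∀ {G G'} → Expand K G → Step G G' → Expand K G'

module Submission where

open import Defs hiding (sym)
open import Data.Bool using (Bool; true; false; if_then_else_)
open import Data.Bool.Properties using (if-swap-then)
open import Data.Empty using (⊥-elim)
open import Data.Fin using (Fin; zero; suc)
open import Data.Fin.Properties using (_≟_)
open import Data.Nat using (ℕ; zero; suc; _+_; _≤_)
open import Data.Nat.Properties using (+-identityʳ; ≤-trans; ≤-reflexive; +-0-commutativeMonoid)
open import Algebra.Properties.CommutativeMonoid.Sum +-0-commutativeMonoid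
  using (sum; sum-cong-≗; ∑-comm)
open import Data.Product using (Σ; _×_; _,_)
open import Data.Sum using (_⊎_; inj₁; inj₂)
open import Function using (_∘_)
open import Function.Bundles using (Equivalence)
open import Relation.Nullary using (does; yes; no)
open import Relation.Binary.PropositionalEquality
  using (_≡_; _≢_; refl; sym; trans; cong; cong₂; module ≡-Reasoning)

-- Every operation of Expand keeps a map φ : V(G) → V(H) under which the
-- fibres are cliques of G and fibres over adjacent vertices of H are
-- completely joined.  Taking s(v) = |φ⁻¹(v)| gives |V(G)| = Σ s, and the
-- preimage of a clique C of H is a clique of G of size Σ_{v ∈ C} s(v) ≤ ω(G).

sumFin-cong : ∀ k {f g : Fin k → ℕ} → (∀ i → f i ≡ g i) → sumFin k f ≡ sumFin k g
sumFin-cong zero    f≗g = refl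
sumFin-cong (suc k) f≗g = cong₂ _+_ (f≗g zero) (sumFin-cong k (f≗g ∘ suc))

sumFin-zero : ∀ k → sumFin k (λ _ → 0) ≡ 0
sumFin-zero zero    = refl
sumFin-zero (suc k) = sumFin-zero k

sumFin-one : ∀ k → sumFin k (λ _ → 1) ≡ k
sumFin-one zero    = refl
sumFin-one (suc k) = cong suc (sumFin-one k)

sumFin≡sum : ∀ k (f : Fin k → ℕ) → sumFin k f ≡ sum f
sumFin≡sum zero    f = refl
sumFin≡sum (suc k) f = cong (f zero +_) (sumFin≡sum k (f ∘ suc))

sumFin-comm : ∀ k m (g : Fin k → Fin m → ℕ) →
  sumFin k (λ i → sumFin m (g i)) ≡ sumFin m (λ j → sumFin k (λ i → g i j))
sumFin-comm k m g = begin
  sumFin k (λ i → sumFin m (g i))     ≡⟨ sumFin≡sum k _ ⟩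
  sum (λ i → sumFin m (g i))          ≡⟨ sum-cong-≗ (λ i → sumFin≡sum m (g i)) ⟩
  sum (λ i → sum (g i))               ≡⟨ ∑-comm g ⟩
  sum (λ j → sum (λ i → g i j))       ≡⟨ sym (sum-cong-≗ (λ j → sumFin≡sum k (λ i → g i j))) ⟩
  sum (λ j → sumFin k (λ i → g i j))  ≡⟨ sym (sumFin≡sum m _) ⟩
  sumFin m (λ j → sumFin k (λ i → g i j)) ∎
  where open ≡-Reasoning

if-then-sumFin : ∀ m (c : Bool) (g : Fin m → ℕ) →
  (if c then sumFin m g else 0) ≡ sumFin m (λ j → if c then g j else 0)
if-then-sumFin m true  g = refl
if-then-sumFin m false g = sym (sumFin-zero m)

sumFin-indicator : ∀ k (a : Fin k) (f : Fin k → ℕ) →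
  sumFin k (λ v → if does (a ≟ v) then f v else 0) ≡ f a
sumFin-indicator (suc k) zero    f = trans (cong (f zero +_) (sumFin-zero k)) (+-identityʳ (f zero))
sumFin-indicator (suc k) (suc a) f = sumFin-indicator k a (f ∘ suc)

fibreSize : ∀ {m k} → (Fin m → Fin k) → Fin k → ℕ
fibreSize {m} φ v = sumFin m (λ x → if does (φ x ≟ v) then 1 else 0)

-- Double counting the pairs (x , v) with φ x ≡ v and C v.
sumFin-fibreSize : ∀ m k (φ : Fin m → Fin k) (C : Fin k → Bool) →
  sumFin k (λ v → if C v then fibreSize φ v else 0) ≡ sumFin m (λ x → if C (φ x) then 1 else 0)
sumFin-fibreSize m k φ C = begin
  sumFin k (λ v → if C v then fibreSize φ v else 0)
    ≡⟨ sumFin-cong k (λ v → if-then-sumFin m (C v) _) ⟩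
  sumFin k (λ v → sumFin m (λ x → if C v then (if does (φ x ≟ v) then 1 else 0) else 0))
    ≡⟨ sumFin-comm k m _ ⟩
  sumFin m (λ x → sumFin k (λ v → if C v then (if does (φ x ≟ v) then 1 else 0) else 0))
    ≡⟨ sumFin-cong m (λ x → sumFin-cong k (λ v → if-swap-then (C v) (does (φ x ≟ v)))) ⟩
  sumFin m (λ x → sumFin k (λ v → if does (φ x ≟ v) then (if C v then 1 else 0) else 0))
    ≡⟨ sumFin-cong m (λ x → sumFin-indicator k (φ x) _) ⟩
  sumFin m (λ x → if C (φ x) then 1 else 0) ∎
  where open ≡-Reasoning

-- G contains, as a spanning subgraph, the blow-up of H in which each vertex v
-- is replaced by the clique on the fibre of collapse over v.
record Blowup (H G : Graph) : Set where
  field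
    collapse : Vertex G → Vertex H
    lift-adj : ∀ x y → x ≢ y →
      collapse x ≡ collapse y ⊎ Adj H (collapse x) (collapse y) → Adj G x y
open Blowup

blowup-refl : ∀ H → Blowup H H
blowup-refl H = record
  { collapse = λ x → x
  ; lift-adj = λ { x y x≢y (inj₁ x≡y) → ⊥-elim (x≢y x≡y) ; x y _ (inj₂ xy) → xy }
  }

blowup-remove : ∀ {H G G'} v → Blowup H G → RemoveVertex G G' v → Blowup H G'
blowup-remove v b (f , f-inj , _ , _ , f-adj) = record
  { collapse = collapse b ∘ f
  ; lift-adj = λ x y x≢y h → trans (f-adj x y) (lift-adj b (f x) (f y) (x≢y ∘ f-inj x y) h)
  }

blowup-replace : ∀ {H G G'} v → Blowup H G → ReplaceByClique G G' v → Blowup H G'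
blowup-replace {H} {G' = G'} v b (p , _ , _ , p-adj) = record
  { collapse = collapse b ∘ p
  ; lift-adj = lift
  }
  where
  lift : ∀ x y → x ≢ y →
    collapse b (p x) ≡ collapse b (p y) ⊎ Adj H (collapse b (p x)) (collapse b (p y)) → Adj G' x y
  lift x y x≢y h with p x ≟ p y
  ... | yes px≡py = Equivalence.from (p-adj x y x≢y) (inj₁ px≡py)
  ... | no  px≢py = Equivalence.from (p-adj x y x≢y) (inj₂ (lift-adj b (p x) (p y) px≢py h))

blowup-addEdge : ∀ {H G G'} → Blowup H G → AddEdge G G' → Blowup H G'
blowup-addEdge b (_ , _ , _ , _ , e , e-inj , _ , e-adj) = record
  { collapse = collapse b ∘ e
  ; lift-adj = λ x y x≢y h →
      Equivalence.from (e-adj x y) (inj₁ (lift-adj b (e x) (e y) (x≢y ∘ e-inj x y) h))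
  }

blowup-step : ∀ {H G G'} → Blowup H G → Step G G' → Blowup H G'
blowup-step b (remove v r)  = blowup-remove v b r
blowup-step b (replace v r) = blowup-replace v b r
blowup-step b (addEdge a)   = blowup-addEdge b a

expand⇒blowup : ∀ {H G} → Expand H G → Blowup H G
expand⇒blowup {H} done     = blowup-refl H
expand⇒blowup (step ex st) = blowup-step (expand⇒blowup ex) st

preimage-isClique : ∀ {H G} (b : Blowup H G) {C : VSet H} →
  IsClique H C → IsClique G (C ∘ collapse b)
preimage-isClique b cl x y Cx Cy x≢y with collapse b x ≟ collapse b y
... | yes φx≡φy = lift-adj b x y x≢y (inj₁ φx≡φy)
... | no  φx≢φy = lift-adj b x y x≢y (inj₂ (cl _ _ Cx Cy φx≢φy))

proposition2 : (H G : Graph) → Expand H G → (w : ℕ) → IsCliqueNumber G w →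
    Σ (Vertex H → ℕ) λ s →
      (n G ≡ sumFin (n H) s) ×
      (∀ C → IsClique H C → sumOver H C s ≤ w)
proposition2 H G ex w (_ , clique≤w) = fibreSize φ , vertexCount , cliqueBound
  where
  b : Blowup H G
  b = expand⇒blowup ex

  φ : Vertex G → Vertex H
  φ = collapse b

  vertexCount : n G ≡ sumFin (n H) (fibreSize φ)
  vertexCount = sym (trans (sumFin-fibreSize (n G) (n H) φ (λ _ → true)) (sumFin-one (n G)))

  cliqueBound : ∀ C → IsClique H C → sumOver H C (fibreSize φ) ≤ w
  cliqueBound C cl = ≤-trans (≤-reflexive (sumFin-fibreSize (n G) (n H) φ C))
                             (clique≤w (C ∘ φ) (preimage-isClique b cl))
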